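{- Let $g:\mathbb{N}\to\mathbb{Z}$ be an arithmetic function with $g(1)=1$. Define polynomials $P_n^g(x)$ by $P_0^g(x)=1$ and $P_n^g(x)=\frac{x}{n}\sum_{k=1}^{n} g(k)\,P_{n-k}^g(x)$ for $n\ge1$, and set $A_n^g(x):=n!\,P_n^g(x)\in\mathbb{Z}[x]$. Let $p$ be a prime. Then for all integers $\ell\ge 0$ and $0\le r<p$, $$A_{\ell p+r}^g(x)\equiv A_r^g(x)\,\bigl(A_p^g(x)\bigr)^{\ell}\pmod p.$$ Further, if all $P_n^g(x)$ ($n\in\mathbb{N}$) are integer-valued polynomials (i.e. $P_n^g(k)\in\mathbb{Z}$ for all $k\in\mathbb{Z}$), then $$A_p^g(x)\equiv x(x-1)\cdots(x-p+1)\pmod p.$$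
   Context: Congruences between polynomials in $\mathbb{Z}[x]$ modulo $p$ are coefficientwise, i.e. equality in $\mathbb{F}_p[x]$. -}

module Defs where

open import Data.Nat using (ℕ; zero; suc; _!) renaming (_*_ to _*ℕ_)
open import Data.Integer using (ℤ; +_; -[1+_])
open import Data.Rational using (ℚ; _/_; _+_; _*_; _-_; 0ℚ; 1ℚ)
open import Data.List using (List; []; _∷_; map)
open import Data.Product using (∃)
open import Relation.Binary.PropositionalEquality using (_≡_)

-- Polynomials with rational coefficients, as coefficient lists
-- (constant term first). Trailing zeros are allowed; all notions
-- below (coeff, eval, congruence) are insensitive to them.
Poly : Set
Poly = List ℚ

ι : ℤ → ℚ
ι z = z / 1

_+ₚ_ : Poly → Poly → Poly
[]      +ₚ q       = q
(a ∷ p) +ₚ []      = a ∷ p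
(a ∷ p) +ₚ (b ∷ q) = (a + b) ∷ (p +ₚ q)

scale : ℚ → Poly → Poly
scale c p = map (c *_) p

X* : Poly → Poly
X* p = 0ℚ ∷ p

_*ₚ_ : Poly → Poly → Poly
[]      *ₚ q = []
(a ∷ p) *ₚ q = scale a q +ₚ X* (p *ₚ q)

oneₚ : Poly
oneₚ = 1ℚ ∷ []

_^ₚ_ : Poly → ℕ → Poly
p ^ₚ zero  = oneₚ
p ^ₚ suc n = p *ₚ (p ^ₚ n)

coeff : Poly → ℕ → ℚ
coeff []      _       = 0ℚ
coeff (a ∷ p) zero    = a
coeff (a ∷ p) (suc i) = coeff p i

eval : Poly → ℚ → ℚ
eval []      t = 0ℚ
eval (a ∷ p) t = a + t * eval p t

weightedSum : (ℕ → ℤ) → ℕ → List Poly → Poly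
weightedSum g j []       = []
weightedSum g j (Q ∷ Qs) = scale (ι (g (suc j))) Q +ₚ weightedSum g (suc j) Qs

-- Ps g m = [P_m, P_{m-1}, ..., P_0]  (so its (k-1)-th entry is P_{m+1-k})
-- P_0 = 1,  P_n = (x/n) Σ_{k=1}^{n} g(k) P_{n-k}
Ps : (ℕ → ℤ) → ℕ → List Poly
Ps g zero    = oneₚ ∷ []
Ps g (suc m) = scale (+ 1 / suc m) (X* (weightedSum g 0 (Ps g m))) ∷ Ps g m

headₚ : List Poly → Poly
headₚ []      = []
headₚ (Q ∷ _) = Q

P : (ℕ → ℤ) → ℕ → Poly
P g n = headₚ (Ps g n)

A : (ℕ → ℤ) → ℕ → Poly
A g n = scale (ι (+ (n !))) (P g n)

_≡ₚ_[mod_] : Poly → Poly → ℕ → Set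
F ≡ₚ G [mod p ] = ∀ i → ∃ λ (z : ℤ) → coeff F i - coeff G i ≡ ι (+ p) * ι z

fall : ℕ → Poly
fall zero    = oneₚ
fall (suc m) = fall m *ₚ (ι (Data.Integer.- (+ m)) ∷ 1ℚ ∷ [])

IntegerValued : (ℕ → ℤ) → Set
IntegerValued g = ∀ (n : ℕ) (k : ℤ) → ∃ λ (z : ℤ) → eval (P g n) (ι k) ≡ ι z

-- Write a_n for the integer coefficient sequence of A_n = n! P_n. Multiplying the
-- recurrence for P_{m+1} by (m+1)! gives a_{m+1}(i+1) = Σ_{u≤m} g(u+1) m!/(m−u)! a_{m−u}(i).
-- The falling factorial m!/(m−u)! = m(m−1)⋯(m−u+1) only depends on m modulo p, and for
-- m = ℓp + s it vanishes modulo p once u > s; so a strong induction on r, layer by layer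
-- in ℓ, gives a_{ℓp+r} ≡ a_r · a_p^ℓ. For the second claim, A_p and x(x−1)⋯(x−p+1) are
-- both monic of degree p (using g(1) = 1), so their difference has degree < p; it vanishes
-- modulo p at 0, …, p−1, since A_p(j) = p! P_p(j) with P_p(j) ∈ ℤ. A polynomial of degree
-- < p over 𝔽_p with p roots is zero.

module Submission where

open import Defs
open import Data.Nat using (ℕ; _*_; _+_; _<_)
open import Data.Nat.Primality using (Prime)
open import Data.Integer using (ℤ; +_)
open import Data.Product using (_×_)
open import Relation.Binary.PropositionalEquality using (_≡_)

open import Data.Nat using (zero; suc; _∸_; _≤_; z≤n; s≤s; _!; NonZero)
import Data.Nat.Properties as ℕ
open import Data.Nat.Induction using (<-rec)
import Data.Nat.Divisibility as ℕᵈ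
open import Data.Nat.Primality using (euclidsLemma; prime⇒nonZero)
open import Data.Nat.Coprimality using (1-coprimeTo) renaming (sym to coprime-sym)
open import Data.Integer using (-[1+_]; ∣_∣)
  renaming (_+_ to _+ᶻ_; _*_ to _*ᶻ_; _-_ to _-ᶻ_; -_ to -ᶻ_)
import Data.Integer.Properties as ℤ
open import Data.Integer.Divisibility.Signed
  using (_∣_; divides; ∣ᵤ⇒∣; ∣⇒∣ᵤ; ∣m⇒∣-m; ∣m∣n⇒∣m+n;
         ∣m+n∣m⇒∣n; ∣m+n∣n⇒∣m; ∣m⇒∣m*n; ∣n⇒∣m*n)
open import Data.Integer.Tactic.RingSolver using (solve-∀)
open import Data.Rational using (ℚ; mkℚ; _/_; ↥_; 0ℚ; 1ℚ)
  renaming (_+_ to _+ᵠ_; _*_ to _*ᵠ_; _-_ to _-ᵠ_; -_ to -ᵠ_)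
import Data.Rational.Properties as ℚ
open import Data.Fin using (toℕ; fromℕ<)
open import Data.Fin.Properties using (toℕ-fromℕ<)
open import Data.List using (List; []; _∷_; length; tabulate)
open import Data.List.Properties using (length-tabulate)
open import Data.List.Relation.Unary.All using (All; []; _∷_)
open import Data.List.Relation.Unary.All.Properties using (tabulate⁻)
open import Data.Product using (_,_; proj₁; proj₂)
open import Data.Sum using (inj₁; inj₂)
open import Data.Empty using (⊥-elim)
open import Data.Maybe using (nothing)
open import Function using (_∘_)
open import Level using (0ℓ)
open import Relation.Binary using (Setoid)
open import Relation.Binary.PropositionalEquality
  using (refl; sym; trans; cong; cong₂; subst; subst₂; module ≡-Reasoning)
open import Relation.Nullary using (yes; no)
import Tactic.RingSolver.Core.AlmostCommutativeRing as ACR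
open import Tactic.RingSolver using () renaming (solve-∀ to solve-∀-over)

ℚ-ring : ACR.AlmostCommutativeRing 0ℓ 0ℓ
ℚ-ring = ACR.fromCommutativeRing ℚ.+-*-commutativeRing (λ _ → nothing)

ι≡mkℚ : ∀ a → ι a ≡ mkℚ a 0 (coprime-sym (1-coprimeTo ∣ a ∣))
ι≡mkℚ (+ n)    = ℚ.normalize-coprime (coprime-sym (1-coprimeTo n))
ι≡mkℚ -[1+ n ] = cong -ᵠ_ (ℚ.normalize-coprime (coprime-sym (1-coprimeTo (suc n))))

ι-homo-+ : ∀ a b → ι (a +ᶻ b) ≡ ι a +ᵠ ι b
ι-homo-+ a b rewrite ι≡mkℚ a | ι≡mkℚ b = cong ι (sym (a*1+b*1≡a+b a b))
  where
  a*1+b*1≡a+b : ∀ a b → a *ᶻ + 1 +ᶻ b *ᶻ + 1 ≡ a +ᶻ b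
  a*1+b*1≡a+b = solve-∀

ι-homo-* : ∀ a b → ι (a *ᶻ b) ≡ ι a *ᵠ ι b
ι-homo-* a b rewrite ι≡mkℚ a | ι≡mkℚ b = refl

ι-homo-‿- : ∀ a → ι (-ᶻ a) ≡ -ᵠ ι a
ι-homo-‿- (+ zero)  = refl
ι-homo-‿- (+ suc n) = refl
ι-homo-‿- -[1+ n ] rewrite ℚ.normalize-coprime {suc n} {0} (coprime-sym (1-coprimeTo (suc n))) = refl

ι-homo-- : ∀ a b → ι (a -ᶻ b) ≡ ι a -ᵠ ι b
ι-homo-- a b = trans (ι-homo-+ a (-ᶻ b)) (cong (ι a +ᵠ_) (ι-homo-‿- b))

ι-homo-*+ : ∀ a b c → ι (a *ᶻ b +ᶻ c) ≡ ι a *ᵠ ι b +ᵠ ι c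
ι-homo-*+ a b c = trans (ι-homo-+ (a *ᶻ b) c) (cong (_+ᵠ ι c) (ι-homo-* a b))

ι-injective : ∀ {a b} → ι a ≡ ι b → a ≡ b
ι-injective {a} {b} eq rewrite ι≡mkℚ a | ι≡mkℚ b = cong ↥_ eq

ι[1+n]*1/[1+n]≡1 : ∀ n → ι (+ suc n) *ᵠ (+ 1 / suc n) ≡ 1ℚ
ι[1+n]*1/[1+n]≡1 n
  rewrite ι≡mkℚ (+ suc n) | ℚ.normalize-coprime {1} {n} (1-coprimeTo (suc n)) =
  ℚ.*-inverseʳ (mkℚ (+ suc n) 0 (coprime-sym (1-coprimeTo (suc n))))

-- Integer coefficient sequences

IntCoeffs : Poly → (ℕ → ℤ) → Set
IntCoeffs F f = ∀ i → coeff F i ≡ ι (f i)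

shift : (ℕ → ℤ) → ℕ → ℤ
shift f zero    = + 0
shift f (suc i) = f i

δ : ℕ → ℤ
δ zero    = + 1
δ (suc _) = + 0

infixl 7 _⋆_

_⋆_ : (ℕ → ℤ) → (ℕ → ℤ) → ℕ → ℤ
(f ⋆ h) zero    = f 0 *ᶻ h 0
(f ⋆ h) (suc i) = f 0 *ᶻ h (suc i) +ᶻ (f ∘ suc ⋆ h) i

coeff-+ₚ : ∀ F G i → coeff (F +ₚ G) i ≡ coeff F i +ᵠ coeff G i
coeff-+ₚ []      G       i       = sym (ℚ.+-identityˡ _)
coeff-+ₚ (a ∷ F) []      i       = sym (ℚ.+-identityʳ _)
coeff-+ₚ (a ∷ F) (b ∷ G) zero    = refl
coeff-+ₚ (a ∷ F) (b ∷ G) (suc i) = coeff-+ₚ F G i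

coeff-scale : ∀ c F i → coeff (scale c F) i ≡ c *ᵠ coeff F i
coeff-scale c []      i       = sym (ℚ.*-zeroʳ c)
coeff-scale c (a ∷ F) zero    = refl
coeff-scale c (a ∷ F) (suc i) = coeff-scale c F i

IntCoeffs-[] : ∀ {f} → IntCoeffs [] f → ∀ i → f i ≡ + 0
IntCoeffs-[] F i = ι-injective (sym (F i))

IntCoeffs-oneₚ : IntCoeffs oneₚ δ
IntCoeffs-oneₚ zero    = refl
IntCoeffs-oneₚ (suc i) = refl

IntCoeffs-+ₚ : ∀ {F G f h} → IntCoeffs F f → IntCoeffs G h → IntCoeffs (F +ₚ G) (λ i → f i +ᶻ h i)
IntCoeffs-+ₚ {F} {G} {f} {h} Ff Gh i =
  trans (coeff-+ₚ F G i) (trans (cong₂ _+ᵠ_ (Ff i) (Gh i)) (sym (ι-homo-+ (f i) (h i))))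

IntCoeffs-scale : ∀ {F f} c → IntCoeffs F f → IntCoeffs (scale (ι c) F) (λ i → c *ᶻ f i)
IntCoeffs-scale {F} {f} c Ff i =
  trans (coeff-scale (ι c) F i) (trans (cong (ι c *ᵠ_) (Ff i)) (sym (ι-homo-* c (f i))))

⋆-zeroˡ : ∀ {f} h → (∀ j → f j ≡ + 0) → ∀ i → (f ⋆ h) i ≡ + 0
⋆-zeroˡ h f≡0 zero    rewrite f≡0 0 = refl
⋆-zeroˡ h f≡0 (suc i) rewrite f≡0 0 = trans (ℤ.+-identityˡ _) (⋆-zeroˡ h (f≡0 ∘ suc) i)

IntCoeffs-*ₚ : ∀ {F G f h} → IntCoeffs F f → IntCoeffs G h → IntCoeffs (F *ₚ G) (f ⋆ h)
IntCoeffs-*ₚ {[]} {G} {f} {h} Ff Gh i = sym (cong ι (⋆-zeroˡ h (IntCoeffs-[] Ff) i))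
IntCoeffs-*ₚ {a ∷ F} {G} {f} {h} Ff Gh i = begin
  coeff (scale a G +ₚ X* (F *ₚ G)) i           ≡⟨ coeff-+ₚ (scale a G) (X* (F *ₚ G)) i ⟩
  coeff (scale a G) i +ᵠ coeff (X* (F *ₚ G)) i  ≡⟨ cong₂ _+ᵠ_ (coeff-scale a G i) (tail i) ⟩
  a *ᵠ coeff G i +ᵠ ι (rest i)                  ≡⟨ cong₂ (λ x y → x *ᵠ y +ᵠ ι (rest i)) (Ff 0) (Gh i) ⟩
  ι (f 0) *ᵠ ι (h i) +ᵠ ι (rest i)              ≡⟨ sym (ι-homo-*+ (f 0) (h i) (rest i)) ⟩
  ι (f 0 *ᶻ h i +ᶻ rest i)                      ≡⟨ cong ι (split i) ⟩
  ι ((f ⋆ h) i)                                 ∎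
  where
  open ≡-Reasoning
  rest : ℕ → ℤ
  rest = shift (f ∘ suc ⋆ h)
  tail : ∀ i → coeff (X* (F *ₚ G)) i ≡ ι (rest i)
  tail zero    = refl
  tail (suc i) = IntCoeffs-*ₚ {F} {G} (Ff ∘ suc) Gh i
  split : ∀ i → f 0 *ᶻ h i +ᶻ rest i ≡ (f ⋆ h) i
  split zero    = ℤ.+-identityʳ (f 0 *ᶻ h 0)
  split (suc i) = refl

sum : ℕ → (ℕ → ℤ) → ℤ
sum zero    f = + 0
sum (suc n) f = f 0 +ᶻ sum n (f ∘ suc)

sum-cong : ∀ n {f h} → (∀ u → f u ≡ h u) → sum n f ≡ sum n h
sum-cong zero    f≡h = refl
sum-cong (suc n) f≡h = cong₂ _+ᶻ_ (f≡h 0) (sum-cong n (f≡h ∘ suc))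

sum-vanishes : ∀ n f → (∀ u → u < n → f u ≡ + 0) → sum n f ≡ + 0
sum-vanishes zero    f f≡0 = refl
sum-vanishes (suc n) f f≡0 rewrite f≡0 0 (s≤s z≤n) =
  trans (ℤ.+-identityˡ _) (sum-vanishes n (f ∘ suc) (λ u u<n → f≡0 (suc u) (s≤s u<n)))

sum-truncate : ∀ k n f → k ≤ n → (∀ u → k ≤ u → f u ≡ + 0) → sum n f ≡ sum k f
sum-truncate zero    n       f k≤n       f≡0 = sum-vanishes n f (λ u _ → f≡0 u z≤n)
sum-truncate (suc k) (suc n) f (s≤s k≤n) f≡0 =
  cong (f 0 +ᶻ_) (sum-truncate k n (f ∘ suc) k≤n (λ u k≤u → f≡0 (suc u) (s≤s k≤u)))

sum-distrib-+ : ∀ n f h → sum n f +ᶻ sum n h ≡ sum n (λ u → f u +ᶻ h u)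
sum-distrib-+ zero    f h = refl
sum-distrib-+ (suc n) f h =
  trans (interchange (f 0) (h 0) (sum n (f ∘ suc)) (sum n (h ∘ suc)))
        (cong (f 0 +ᶻ h 0 +ᶻ_) (sum-distrib-+ n (f ∘ suc) (h ∘ suc)))
  where
  interchange : ∀ a b c d → a +ᶻ c +ᶻ (b +ᶻ d) ≡ a +ᶻ b +ᶻ (c +ᶻ d)
  interchange = solve-∀

sum-distribʳ-* : ∀ n f c → sum n f *ᶻ c ≡ sum n (λ u → f u *ᶻ c)
sum-distribʳ-* zero    f c = refl
sum-distribʳ-* (suc n) f c =
  trans (ℤ.*-distribʳ-+ c (f 0) (sum n (f ∘ suc))) (cong (f 0 *ᶻ c +ᶻ_) (sum-distribʳ-* n (f ∘ suc) c))

⋆-congˡ : ∀ {f f′} h → (∀ j → f j ≡ f′ j) → ∀ i → (f ⋆ h) i ≡ (f′ ⋆ h) i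
⋆-congˡ h f≡f′ zero    = cong (_*ᶻ h 0) (f≡f′ 0)
⋆-congˡ h f≡f′ (suc i) = cong₂ _+ᶻ_ (cong (_*ᶻ h (suc i)) (f≡f′ 0)) (⋆-congˡ h (f≡f′ ∘ suc) i)

⋆-identityˡ : ∀ h i → (δ ⋆ h) i ≡ h i
⋆-identityˡ h zero    = ℤ.*-identityˡ (h 0)
⋆-identityˡ h (suc i) =
  trans (cong₂ _+ᶻ_ (ℤ.*-identityˡ (h (suc i))) (⋆-zeroˡ h (λ _ → refl) i)) (ℤ.+-identityʳ _)

⋆-identityʳ : ∀ f i → (f ⋆ δ) i ≡ f i
⋆-identityʳ f zero    = ℤ.*-identityʳ (f 0)
⋆-identityʳ f (suc i) =
  trans (cong₂ _+ᶻ_ (ℤ.*-zeroʳ (f 0)) (⋆-identityʳ (f ∘ suc) i)) (ℤ.+-identityˡ _)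

⋆-shiftˡ : ∀ f h i → (shift f ⋆ h) (suc i) ≡ (f ⋆ h) i
⋆-shiftˡ f h i = ℤ.+-identityˡ _

*-⋆-assoc : ∀ c f h i → ((λ j → c *ᶻ f j) ⋆ h) i ≡ c *ᶻ (f ⋆ h) i
*-⋆-assoc c f h zero    = ℤ.*-assoc c (f 0) (h 0)
*-⋆-assoc c f h (suc i) =
  trans (cong (c *ᶻ f 0 *ᶻ h (suc i) +ᶻ_) (*-⋆-assoc c (f ∘ suc) h i))
        (assoc-distrib c (f 0) (h (suc i)) ((f ∘ suc ⋆ h) i))
  where
  assoc-distrib : ∀ c a b x → c *ᶻ a *ᶻ b +ᶻ c *ᶻ x ≡ c *ᶻ (a *ᶻ b +ᶻ x)
  assoc-distrib = solve-∀

sum-⋆ : ∀ n (F : ℕ → ℕ → ℤ) h i → ((λ j → sum n (λ u → F u j)) ⋆ h) i ≡ sum n (λ u → (F u ⋆ h) i)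
sum-⋆ n F h zero    = sum-distribʳ-* n (λ u → F u 0) (h 0)
sum-⋆ n F h (suc i) =
  trans (cong₂ _+ᶻ_ (sum-distribʳ-* n (λ u → F u 0) (h (suc i))) (sum-⋆ n (λ u j → F u (suc j)) h i))
        (sum-distrib-+ n (λ u → F u 0 *ᶻ h (suc i)) (λ u → (F u ∘ suc ⋆ h) i))

⋆-linear : ∀ f h → (∀ j → h (suc (suc j)) ≡ + 0) →
  ∀ i → (f ⋆ h) (suc i) ≡ f (suc i) *ᶻ h 0 +ᶻ f i *ᶻ h 1
⋆-linear f h h≡0 zero    = ℤ.+-comm (f 0 *ᶻ h 1) (f 1 *ᶻ h 0)
⋆-linear f h h≡0 (suc i) rewrite h≡0 i | ⋆-linear (f ∘ suc) h h≡0 i | ℤ.*-zeroʳ (f 0) = ℤ.+-identityˡ _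

-- Congruences of integers modulo p

module Modulo (p : ℕ) where

  infix 4 _≈_
  record _≈_ (x y : ℤ) : Set where
    constructor divides-difference
    field p∣x-y : + p ∣ x -ᶻ y

  ≈-reflexive : ∀ {x y} → x ≡ y → x ≈ y
  ≈-reflexive {x} refl = divides-difference (subst (+ p ∣_) (sym (ℤ.+-inverseʳ x)) (divides (+ 0) refl))

  ≈-refl : ∀ {x} → x ≈ x
  ≈-refl = ≈-reflexive refl

  ≈-sym : ∀ {x y} → x ≈ y → y ≈ x
  ≈-sym {x} {y} (divides-difference x≈y) = divides-difference (subst (+ p ∣_) (swap x y) (∣m⇒∣-m x≈y))
    where
    swap : ∀ x y → -ᶻ (x -ᶻ y) ≡ y -ᶻ x
    swap = solve-∀

  ≈-trans : ∀ {x y z} → x ≈ y → y ≈ z → x ≈ z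
  ≈-trans {x} {y} {z} (divides-difference x≈y) (divides-difference y≈z) =
    divides-difference (subst (+ p ∣_) (telescope x y z) (∣m∣n⇒∣m+n x≈y y≈z))
    where
    telescope : ∀ x y z → x -ᶻ y +ᶻ (y -ᶻ z) ≡ x -ᶻ z
    telescope = solve-∀

  +-cong : ∀ {x x′ y y′} → x ≈ x′ → y ≈ y′ → x +ᶻ y ≈ x′ +ᶻ y′
  +-cong {x} {x′} {y} {y′} (divides-difference x≈x′) (divides-difference y≈y′) =
    divides-difference (subst (+ p ∣_) (regroup x x′ y y′) (∣m∣n⇒∣m+n x≈x′ y≈y′))
    where
    regroup : ∀ x x′ y y′ → x -ᶻ x′ +ᶻ (y -ᶻ y′) ≡ x +ᶻ y -ᶻ (x′ +ᶻ y′)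
    regroup = solve-∀

  *-cong : ∀ {x x′ y y′} → x ≈ x′ → y ≈ y′ → x *ᶻ y ≈ x′ *ᶻ y′
  *-cong {x} {x′} {y} {y′} (divides-difference x≈x′) (divides-difference y≈y′) =
    divides-difference
      (subst (+ p ∣_) (regroup x x′ y y′) (∣m∣n⇒∣m+n (∣m⇒∣m*n y x≈x′) (∣n⇒∣m*n x′ y≈y′)))
    where
    regroup : ∀ x x′ y y′ → (x -ᶻ x′) *ᶻ y +ᶻ x′ *ᶻ (y -ᶻ y′) ≡ x *ᶻ y -ᶻ x′ *ᶻ y′
    regroup = solve-∀

  ∣⇒≈0 : ∀ {x} → + p ∣ x → x ≈ + 0
  ∣⇒≈0 {x} p∣x = divides-difference (subst (+ p ∣_) (sym (ℤ.+-identityʳ x)) p∣x)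

  ≈0⇒∣ : ∀ {x} → x ≈ + 0 → + p ∣ x
  ≈0⇒∣ {x} (divides-difference p∣x-0) = subst (+ p ∣_) (ℤ.+-identityʳ x) p∣x-0

  +-≈0 : ∀ {x y} → x ≈ + 0 → y ≈ + 0 → x +ᶻ y ≈ + 0
  +-≈0 x≈0 y≈0 = ∣⇒≈0 (∣m∣n⇒∣m+n (≈0⇒∣ x≈0) (≈0⇒∣ y≈0))

  *-≈0 : ∀ x {y} → y ≈ + 0 → x *ᶻ y ≈ + 0
  *-≈0 x y≈0 = ∣⇒≈0 (∣n⇒∣m*n x (≈0⇒∣ y≈0))

  ≈0-cancelˡ : ∀ {x y} → x ≈ + 0 → x +ᶻ y ≈ + 0 → y ≈ + 0
  ≈0-cancelˡ x≈0 x+y≈0 = ∣⇒≈0 (∣m+n∣m⇒∣n (≈0⇒∣ x+y≈0) (≈0⇒∣ x≈0))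

  ≈0-cancelʳ : ∀ {x y} → x +ᶻ y ≈ + 0 → y ≈ + 0 → x ≈ + 0
  ≈0-cancelʳ x+y≈0 y≈0 = ∣⇒≈0 (∣m+n∣n⇒∣m (≈0⇒∣ x+y≈0) (≈0⇒∣ y≈0))

  x-y≈0⇒x≈y : ∀ {x y} → x -ᶻ y ≈ + 0 → x ≈ y
  x-y≈0⇒x≈y x-y≈0 = divides-difference (≈0⇒∣ x-y≈0)

  ℓp+n≈n : ∀ ℓ n → + (ℓ * p + n) ≈ + n
  ℓp+n≈n ℓ n = divides-difference (subst (+ p ∣_) ℓp≡ℓp+n-n (∣ᵤ⇒∣ (ℕᵈ.n∣m*n ℓ)))
    where
    cancel : ∀ x y → x ≡ x +ᶻ y -ᶻ y
    cancel = solve-∀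
    ℓp≡ℓp+n-n : + (ℓ * p) ≡ + (ℓ * p + n) -ᶻ + n
    ℓp≡ℓp+n-n = trans (cancel (+ (ℓ * p)) (+ n)) (cong (_-ᶻ + n) (sym (ℤ.pos-+ (ℓ * p) n)))

  ≈-setoid : Setoid 0ℓ 0ℓ
  ≈-setoid = record
    { Carrier = ℤ ; _≈_ = _≈_
    ; isEquivalence = record { refl = ≈-refl ; sym = ≈-sym ; trans = ≈-trans } }

  IntCoeffs-≡ₚ : ∀ {F G f h} → IntCoeffs F f → IntCoeffs G h → (∀ i → f i ≈ h i) → F ≡ₚ G [mod p ]
  IntCoeffs-≡ₚ {F} {G} {f} {h} Ff Gh f≈h i with f≈h i
  ... | divides-difference (divides q f-h≡qp) = q , (begin
    coeff F i -ᵠ coeff G i  ≡⟨ cong₂ _-ᵠ_ (Ff i) (Gh i) ⟩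
    ι (f i) -ᵠ ι (h i)      ≡⟨ sym (ι-homo-- (f i) (h i)) ⟩
    ι (f i -ᶻ h i)          ≡⟨ cong ι (trans f-h≡qp (ℤ.*-comm q (+ p))) ⟩
    ι (+ p *ᶻ q)            ≡⟨ ι-homo-* (+ p) q ⟩
    ι (+ p) *ᵠ ι q          ∎)
    where open ≡-Reasoning

  sum-cong-≈ : ∀ n {f h} → (∀ u → u < n → f u ≈ h u) → sum n f ≈ sum n h
  sum-cong-≈ zero    f≈h = ≈-refl
  sum-cong-≈ (suc n) f≈h = +-cong (f≈h 0 (s≤s z≤n)) (sum-cong-≈ n (λ u u<n → f≈h (suc u) (s≤s u<n)))

ffact : ℕ → ℕ → ℕ
ffact n       zero    = 1
ffact zero    (suc t) = 0
ffact (suc n) (suc t) = suc n * ffact n t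

ffact-suc : ∀ n t → ffact n (suc t) ≡ n * ffact (n ∸ 1) t
ffact-suc zero    t = refl
ffact-suc (suc n) t = refl

ffact-vanishes : ∀ {s u} → s < u → ffact s u ≡ 0
ffact-vanishes {zero}  {suc u} _         = refl
ffact-vanishes {suc s} {suc u} (s≤s s<u) rewrite ffact-vanishes s<u = ℕ.*-zeroʳ (suc s)

factorial-split : ∀ t k → (t + k) ! ≡ ffact (t + k) t * k !
factorial-split zero    k = sym (ℕ.+-identityʳ (k !))
factorial-split (suc t) k =
  trans (cong (suc (t + k) *_) (factorial-split t k)) (sym (ℕ.*-assoc (suc (t + k)) (ffact (t + k) t) (k !)))

module _ (p : ℕ) where
  open Modulo p

  ffact-periodic : ∀ ℓ s u → + ffact (ℓ * p + s) u ≈ + ffact s u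
  ffact-periodic ℓ s       zero    = ≈-refl
  ffact-periodic ℓ zero    (suc u) = ∣⇒≈0 (∣ᵤ⇒∣ p∣ffact)
    where
    p∣ffact : p ℕᵈ.∣ ffact (ℓ * p + 0) (suc u)
    p∣ffact rewrite ffact-suc (ℓ * p + 0) u | ℕ.+-identityʳ (ℓ * p) = ℕᵈ.∣m⇒∣m*n _ (ℕᵈ.n∣m*n ℓ)
  ffact-periodic ℓ (suc s) (suc u) rewrite ℕ.+-suc (ℓ * p) s =
    subst₂ _≈_ (sym (ℤ.pos-* (suc (ℓ * p + s)) _)) (sym (ℤ.pos-* (suc s) _))
      (*-cong (subst (λ n → + n ≈ + suc s) (ℕ.+-suc (ℓ * p) s) (ℓp+n≈n ℓ (suc s))) (ffact-periodic ℓ s u))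

MonicOfDegree : ℕ → (ℕ → ℤ) → Set
MonicOfDegree n f = (∀ i → n < i → f i ≡ + 0) × f n ≡ + 1

-- The integer coefficients of A_n

-- as m lists a_m, …, a_0 in the shape of Ps g m, so that the recursions for a and P
-- can be compared entry by entry.
module Coefficients (g : ℕ → ℤ) where

  weighted : ℕ → ℕ → List (ℕ → ℤ) → ℕ → ℤ
  weighted m t []       i = + 0
  weighted m t (f ∷ fs) i = g (suc t) *ᶻ + ffact m t *ᶻ f i +ᶻ weighted m (suc t) fs i

  as : ℕ → List (ℕ → ℤ)
  a  : ℕ → ℕ → ℤ
  as zero    = a zero ∷ []
  as (suc m) = a (suc m) ∷ as m
  a zero    = δ
  a (suc m) = shift (weighted m 0 (as m))

  weighted-as : ∀ m t k i →
    weighted m t (as k) i ≡ sum (suc k) (λ u → g (suc (t + u)) *ᶻ + ffact m (t + u) *ᶻ a (k ∸ u) i)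
  weighted-as m t zero    i rewrite ℕ.+-identityʳ t = refl
  weighted-as m t (suc k) i =
    cong₂ _+ᶻ_ (cong (λ v → g (suc v) *ᶻ + ffact m v *ᶻ a (suc k) i) (sym (ℕ.+-identityʳ t)))
      (trans (weighted-as m (suc t) k i)
             (sum-cong (suc k) (λ u → cong (λ v → g (suc v) *ᶻ + ffact m v *ᶻ a (k ∸ u) i) (sym (ℕ.+-suc t u)))))

  a-recurrence : ∀ m i → a (suc m) (suc i) ≡ sum (suc m) (λ u → g (suc u) *ᶻ + ffact m u *ᶻ a (m ∸ u) i)
  a-recurrence m i = weighted-as m 0 m i

  weightedSum-IntCoeffs-∷ : ∀ m t k {Qs fs} → t + k ≡ m → IntCoeffs (A g k) (a k) →
    IntCoeffs (scale (ι (+ (m !))) (weightedSum g (suc t) Qs)) (weighted m (suc t) fs) →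
    IntCoeffs (scale (ι (+ (m !))) (weightedSum g t (P g k ∷ Qs))) (weighted m t (a k ∷ fs))
  weightedSum-IntCoeffs-∷ m t k {Qs} {fs} t+k≡m Aₖ rest i = begin
    coeff (scale M (scale G (P g k) +ₚ W)) i
      ≡⟨ coeff-scale M (scale G (P g k) +ₚ W) i ⟩
    M *ᵠ coeff (scale G (P g k) +ₚ W) i
      ≡⟨ cong (M *ᵠ_) (trans (coeff-+ₚ (scale G (P g k)) W i) (cong (_+ᵠ coeff W i) (coeff-scale G (P g k) i))) ⟩
    M *ᵠ (G *ᵠ coeff (P g k) i +ᵠ coeff W i)
      ≡⟨ cong (_*ᵠ (G *ᵠ coeff (P g k) i +ᵠ coeff W i)) M≡F*K ⟩
    F *ᵠ K *ᵠ (G *ᵠ coeff (P g k) i +ᵠ coeff W i)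
      ≡⟨ distribute F K G (coeff (P g k) i) (coeff W i) ⟩
    G *ᵠ F *ᵠ (K *ᵠ coeff (P g k) i) +ᵠ F *ᵠ K *ᵠ coeff W i
      ≡⟨ cong₂ (λ x y → G *ᵠ F *ᵠ x +ᵠ y) head tail ⟩
    G *ᵠ F *ᵠ ι (a k i) +ᵠ ι (weighted m (suc t) fs i)
      ≡⟨ cong (λ x → x *ᵠ ι (a k i) +ᵠ ι (weighted m (suc t) fs i)) (sym (ι-homo-* (g (suc t)) (+ ffact m t))) ⟩
    ι (g (suc t) *ᶻ + ffact m t) *ᵠ ι (a k i) +ᵠ ι (weighted m (suc t) fs i)
      ≡⟨ sym (ι-homo-*+ (g (suc t) *ᶻ + ffact m t) (a k i) (weighted m (suc t) fs i)) ⟩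
    ι (weighted m t (a k ∷ fs) i)
      ∎
    where
    open ≡-Reasoning
    M F K G : ℚ
    M = ι (+ (m !))
    F = ι (+ ffact m t)
    K = ι (+ (k !))
    G = ι (g (suc t))
    W : Poly
    W = weightedSum g (suc t) Qs
    M≡F*K : M ≡ F *ᵠ K
    M≡F*K = trans (cong (ι ∘ +_) (subst (λ n → n ! ≡ ffact n t * k !) t+k≡m (factorial-split t k)))
                  (trans (cong ι (ℤ.pos-* (ffact m t) (k !))) (ι-homo-* (+ ffact m t) (+ (k !))))
    distribute : ∀ F K G x w → F *ᵠ K *ᵠ (G *ᵠ x +ᵠ w) ≡ G *ᵠ F *ᵠ (K *ᵠ x) +ᵠ F *ᵠ K *ᵠ w
    distribute = solve-∀-over ℚ-ring
    head : K *ᵠ coeff (P g k) i ≡ ι (a k i)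
    head = trans (sym (coeff-scale K (P g k) i)) (Aₖ i)
    tail : F *ᵠ K *ᵠ coeff W i ≡ ι (weighted m (suc t) fs i)
    tail = trans (cong (_*ᵠ coeff W i) (sym M≡F*K)) (trans (sym (coeff-scale M W i)) (rest i))

  weightedSum-IntCoeffs : ∀ m → (∀ k → k ≤ m → IntCoeffs (A g k) (a k)) → ∀ k t → t + k ≡ m →
    IntCoeffs (scale (ι (+ (m !))) (weightedSum g t (Ps g k))) (weighted m t (as k))
  weightedSum-IntCoeffs m A≤m zero    t t+k≡m =
    weightedSum-IntCoeffs-∷ m t 0 {[]} {[]} t+k≡m (A≤m 0 z≤n) (λ _ → refl)
  weightedSum-IntCoeffs m A≤m (suc k) t t+k≡m =
    weightedSum-IntCoeffs-∷ m t (suc k) {Ps g k} {as k} t+k≡m (A≤m (suc k) (subst (suc k ≤_) t+k≡m (ℕ.m≤n+m (suc k) t)))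
      (weightedSum-IntCoeffs m A≤m k (suc t) (trans (sym (ℕ.+-suc t k)) t+k≡m))

  ι[1+m]!-cancel : ∀ m w → ι (+ (suc m !)) *ᵠ ((+ 1 / suc m) *ᵠ w) ≡ ι (+ (m !)) *ᵠ w
  ι[1+m]!-cancel m w = begin
    ι (+ (suc m !)) *ᵠ (r *ᵠ w)
      ≡⟨ cong (_*ᵠ (r *ᵠ w)) (trans (cong ι (ℤ.pos-* (suc m) (m !))) (ι-homo-* (+ suc m) (+ (m !)))) ⟩
    ι (+ suc m) *ᵠ ι (+ (m !)) *ᵠ (r *ᵠ w)  ≡⟨ regroup (ι (+ suc m)) (ι (+ (m !))) r w ⟩
    ι (+ suc m) *ᵠ r *ᵠ (ι (+ (m !)) *ᵠ w)  ≡⟨ cong (_*ᵠ (ι (+ (m !)) *ᵠ w)) (ι[1+n]*1/[1+n]≡1 m) ⟩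
    1ℚ *ᵠ (ι (+ (m !)) *ᵠ w)                ≡⟨ ℚ.*-identityˡ _ ⟩
    ι (+ (m !)) *ᵠ w                        ∎
    where
    open ≡-Reasoning
    r : ℚ
    r = + 1 / suc m
    regroup : ∀ s f r w → s *ᵠ f *ᵠ (r *ᵠ w) ≡ s *ᵠ r *ᵠ (f *ᵠ w)
    regroup = solve-∀-over ℚ-ring

  A-IntCoeffs : ∀ n → IntCoeffs (A g n) (a n)
  A-IntCoeffs = <-rec (λ n → IntCoeffs (A g n) (a n)) step
    where
    step : ∀ n → (∀ {k} → k < n → IntCoeffs (A g k) (a k)) → IntCoeffs (A g n) (a n)
    step zero    _  i = trans (coeff-scale 1ℚ oneₚ i) (trans (ℚ.*-identityˡ _) (IntCoeffs-oneₚ i))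
    step (suc m) A<n zero    =
      trans (cong (ι (+ (suc m !)) *ᵠ_) (ℚ.*-zeroʳ (+ 1 / suc m))) (ℚ.*-zeroʳ (ι (+ (suc m !))))
    step (suc m) A<n (suc i) = begin
      coeff (A g (suc m)) (suc i)
        ≡⟨ coeff-scale (ι (+ (suc m !))) (P g (suc m)) (suc i) ⟩
      ι (+ (suc m !)) *ᵠ coeff (P g (suc m)) (suc i)
        ≡⟨ cong (ι (+ (suc m !)) *ᵠ_) (coeff-scale (+ 1 / suc m) (X* W) (suc i)) ⟩
      ι (+ (suc m !)) *ᵠ ((+ 1 / suc m) *ᵠ coeff W i)
        ≡⟨ ι[1+m]!-cancel m (coeff W i) ⟩
      ι (+ (m !)) *ᵠ coeff W i
        ≡⟨ sym (coeff-scale (ι (+ (m !))) W i) ⟩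
      coeff (scale (ι (+ (m !))) W) i
        ≡⟨ weightedSum-IntCoeffs m (λ k k≤m → A<n (s≤s k≤m)) m 0 refl i ⟩
      ι (a (suc m) (suc i))
        ∎
      where
      open ≡-Reasoning
      W : Poly
      W = weightedSum g 0 (Ps g m)

  a-monic : g 1 ≡ + 1 → ∀ n → MonicOfDegree n (a n)
  a-monic g1 = <-rec (λ n → MonicOfDegree n (a n)) step
    where
    step : ∀ n → (∀ {k} → k < n → MonicOfDegree k (a k)) → MonicOfDegree n (a n)
    step zero    _  = (λ { (suc i) _ → refl }) , refl
    step (suc m) IH = vanishing , leading
      where
      lower-vanishes : ∀ u i → m ∸ u < i → g (suc u) *ᶻ + ffact m u *ᶻ a (m ∸ u) i ≡ + 0
      lower-vanishes u i m-u<i =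
        trans (cong (g (suc u) *ᶻ + ffact m u *ᶻ_) (proj₁ (IH (s≤s (ℕ.m∸n≤m m u))) i m-u<i))
              (ℤ.*-zeroʳ (g (suc u) *ᶻ + ffact m u))
      vanishing : ∀ i → suc m < i → a (suc m) i ≡ + 0
      vanishing (suc i) (s≤s m<i) =
        trans (a-recurrence m i) (sum-vanishes (suc m) _ (λ u _ → lower-vanishes u i (ℕ.≤-<-trans (ℕ.m∸n≤m m u) m<i)))
      leading : a (suc m) (suc m) ≡ + 1
      leading = begin
        a (suc m) (suc m)
          ≡⟨ a-recurrence m m ⟩
        g 1 *ᶻ + 1 *ᶻ a m m +ᶻ sum m higher
          ≡⟨ cong₂ (λ x y → x *ᶻ + 1 *ᶻ y +ᶻ sum m higher) g1 (proj₂ (IH (ℕ.n<1+n m))) ⟩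
        + 1 +ᶻ sum m higher
          ≡⟨ cong (+ 1 +ᶻ_) (sum-vanishes m higher (λ u u<m → lower-vanishes (suc u) m (ℕ.∸-monoʳ-< (s≤s z≤n) u<m))) ⟩
        + 1
          ∎
        where
        open ≡-Reasoning
        higher : ℕ → ℤ
        higher u = g (suc (suc u)) *ᶻ + ffact m (suc u) *ᶻ a (m ∸ suc u) m

-- The congruence A_{ℓp+r} ≡ A_r A_p^ℓ (mod p)

module Periodicity (g : ℕ → ℤ) (p : ℕ) where
  open Coefficients g
  open Modulo p

  powA : ℕ → ℕ → ℤ
  powA zero    = δ
  powA (suc ℓ) = a p ⋆ powA ℓ

  powA-IntCoeffs : ∀ ℓ → IntCoeffs (A g p ^ₚ ℓ) (powA ℓ)
  powA-IntCoeffs zero    = IntCoeffs-oneₚ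
  powA-IntCoeffs (suc ℓ) = IntCoeffs-*ₚ {A g p} {A g p ^ₚ ℓ} (A-IntCoeffs p) (powA-IntCoeffs ℓ)

  infix 4 _≋_
  _≋_ : (ℕ → ℤ) → (ℕ → ℤ) → Set
  f ≋ h = ∀ i → f i ≈ h i

  a-suc-periodic : ∀ ℓ s → (∀ r → r ≤ s → a (ℓ * p + r) ≋ a r ⋆ powA ℓ) →
    a (suc (ℓ * p + s)) ≋ a (suc s) ⋆ powA ℓ
  a-suc-periodic ℓ s IH zero    = ≈-reflexive (sym (ℤ.*-zeroˡ (powA ℓ 0)))
  a-suc-periodic ℓ s IH (suc i) = begin
    a (suc m) (suc i)
      ≡⟨ a-recurrence m i ⟩
    sum (suc m) (λ u → g (suc u) *ᶻ + ffact m u *ᶻ a (m ∸ u) i)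
      ≈⟨ sum-cong-≈ (suc m) (λ u _ → *-cong (weight-periodic u) (≈-refl {a (m ∸ u) i})) ⟩
    sum (suc m) (λ u → c u *ᶻ a (m ∸ u) i)
      ≡⟨ sum-truncate (suc s) (suc m) _ (s≤s (ℕ.m≤n+m s (ℓ * p))) c-vanishes ⟩
    sum (suc s) (λ u → c u *ᶻ a (m ∸ u) i)
      ≈⟨ sum-cong-≈ (suc s) (λ u u≤s → *-cong (≈-refl {c u}) (IH′ u u≤s)) ⟩
    sum (suc s) (λ u → c u *ᶻ (a (s ∸ u) ⋆ powA ℓ) i)
      ≡⟨ sum-cong (suc s) (λ u → sym (*-⋆-assoc (c u) (a (s ∸ u)) (powA ℓ) i)) ⟩
    sum (suc s) (λ u → ((λ j → c u *ᶻ a (s ∸ u) j) ⋆ powA ℓ) i)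
      ≡⟨ sym (sum-⋆ (suc s) (λ u j → c u *ᶻ a (s ∸ u) j) (powA ℓ) i) ⟩
    ((λ j → sum (suc s) (λ u → c u *ᶻ a (s ∸ u) j)) ⋆ powA ℓ) i
      ≡⟨ ⋆-congˡ (powA ℓ) (λ j → sym (a-recurrence s j)) i ⟩
    (a (suc s) ∘ suc ⋆ powA ℓ) i
      ≡⟨ sym (⋆-shiftˡ (weighted s 0 (as s)) (powA ℓ) i) ⟩
    (a (suc s) ⋆ powA ℓ) (suc i)
      ∎
    where
    open import Relation.Binary.Reasoning.Setoid ≈-setoid
    m : ℕ
    m = ℓ * p + s
    c : ℕ → ℤ
    c u = g (suc u) *ᶻ + ffact s u
    weight-periodic : ∀ u → g (suc u) *ᶻ + ffact m u ≈ c u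
    weight-periodic u = *-cong (≈-refl {g (suc u)}) (ffact-periodic p ℓ s u)
    c-vanishes : ∀ u → suc s ≤ u → c u *ᶻ a (m ∸ u) i ≡ + 0
    c-vanishes u s<u rewrite ffact-vanishes s<u | ℤ.*-zeroʳ (g (suc u)) = ℤ.*-zeroˡ (a (m ∸ u) i)
    IH′ : ∀ u → u < suc s → a (m ∸ u) i ≈ (a (s ∸ u) ⋆ powA ℓ) i
    IH′ u (s≤s u≤s) rewrite ℕ.+-∸-assoc (ℓ * p) u≤s = IH (s ∸ u) (ℕ.m∸n≤m s u) i

  a-periodic : ∀ ℓ r → a (ℓ * p + r) ≋ a r ⋆ powA ℓ
  a-periodic-start : ∀ ℓ → a (ℓ * p + 0) ≋ a 0 ⋆ powA ℓ

  a-periodic ℓ = <-rec (λ r → a (ℓ * p + r) ≋ a r ⋆ powA ℓ) step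
    where
    step : ∀ r → (∀ {r′} → r′ < r → a (ℓ * p + r′) ≋ a r′ ⋆ powA ℓ) → a (ℓ * p + r) ≋ a r ⋆ powA ℓ
    step zero    _  = a-periodic-start ℓ
    step (suc s) IH = subst (λ n → a n ≋ a (suc s) ⋆ powA ℓ) (sym (ℕ.+-suc (ℓ * p) s))
                            (a-suc-periodic ℓ s (λ r r≤s → IH (s≤s r≤s)))

  -- The case r = p of layer ℓ is the case r = 0 of layer ℓ + 1.
  a-periodic-start zero    i = ≈-reflexive (sym (⋆-identityʳ δ i))
  a-periodic-start (suc ℓ) i =
    subst (λ n → a n i ≈ (a 0 ⋆ powA (suc ℓ)) i) ℓp+p≡[1+ℓ]p+0
      (≈-trans (a-periodic ℓ p i) (≈-reflexive (sym (⋆-identityˡ (powA (suc ℓ)) i))))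
    where
    ℓp+p≡[1+ℓ]p+0 : ℓ * p + p ≡ suc ℓ * p + 0
    ℓp+p≡[1+ℓ]p+0 = trans (ℕ.+-comm (ℓ * p) p) (sym (ℕ.+-identityʳ (suc ℓ * p)))

  A-periodic : ∀ ℓ r → A g (ℓ * p + r) ≡ₚ (A g r *ₚ (A g p ^ₚ ℓ)) [mod p ]
  A-periodic ℓ r =
    IntCoeffs-≡ₚ {A g (ℓ * p + r)} {A g r *ₚ (A g p ^ₚ ℓ)} (A-IntCoeffs (ℓ * p + r))
      (IntCoeffs-*ₚ {A g r} {A g p ^ₚ ℓ} (A-IntCoeffs r) (powA-IntCoeffs ℓ)) (a-periodic ℓ r)

eval-+ₚ : ∀ F G t → eval (F +ₚ G) t ≡ eval F t +ᵠ eval G t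
eval-+ₚ []      G       t = sym (ℚ.+-identityˡ _)
eval-+ₚ (a ∷ F) []      t = sym (ℚ.+-identityʳ _)
eval-+ₚ (a ∷ F) (b ∷ G) t =
  trans (cong (λ v → a +ᵠ b +ᵠ t *ᵠ v) (eval-+ₚ F G t)) (interchange a b t (eval F t) (eval G t))
  where
  interchange : ∀ a b t x y → a +ᵠ b +ᵠ t *ᵠ (x +ᵠ y) ≡ a +ᵠ t *ᵠ x +ᵠ (b +ᵠ t *ᵠ y)
  interchange = solve-∀-over ℚ-ring

eval-scale : ∀ c F t → eval (scale c F) t ≡ c *ᵠ eval F t
eval-scale c []      t = sym (ℚ.*-zeroʳ c)
eval-scale c (a ∷ F) t = trans (cong (λ v → c *ᵠ a +ᵠ t *ᵠ v) (eval-scale c F t)) (factor c a t (eval F t))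
  where
  factor : ∀ c a t x → c *ᵠ a +ᵠ t *ᵠ (c *ᵠ x) ≡ c *ᵠ (a +ᵠ t *ᵠ x)
  factor = solve-∀-over ℚ-ring

eval-*ₚ : ∀ F G t → eval (F *ₚ G) t ≡ eval F t *ᵠ eval G t
eval-*ₚ []      G t = sym (ℚ.*-zeroˡ (eval G t))
eval-*ₚ (a ∷ F) G t = begin
  eval (scale a G +ₚ X* (F *ₚ G)) t               ≡⟨ eval-+ₚ (scale a G) (X* (F *ₚ G)) t ⟩
  eval (scale a G) t +ᵠ (0ℚ +ᵠ t *ᵠ eval (F *ₚ G) t) ≡⟨ cong₂ _+ᵠ_ (eval-scale a G t) (ℚ.+-identityˡ _) ⟩
  a *ᵠ eval G t +ᵠ t *ᵠ eval (F *ₚ G) t            ≡⟨ cong (λ v → a *ᵠ eval G t +ᵠ t *ᵠ v) (eval-*ₚ F G t) ⟩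
  a *ᵠ eval G t +ᵠ t *ᵠ (eval F t *ᵠ eval G t)     ≡⟨ factor a t (eval F t) (eval G t) ⟩
  (a +ᵠ t *ᵠ eval F t) *ᵠ eval G t                 ∎
  where
  open ≡-Reasoning
  factor : ∀ a t x y → a *ᵠ y +ᵠ t *ᵠ (x *ᵠ y) ≡ (a +ᵠ t *ᵠ x) *ᵠ y
  factor = solve-∀-over ℚ-ring

linear : ℕ → Poly
linear m = ι (-ᶻ (+ m)) ∷ 1ℚ ∷ []

eval-linear-root : ∀ m → eval (linear m) (ι (+ m)) ≡ 0ℚ
eval-linear-root m rewrite ι-homo-‿- (+ m) | ℚ.*-zeroʳ (ι (+ m)) | ℚ.*-identityʳ (ι (+ m)) =
  ℚ.+-inverseˡ (ι (+ m))

fall-root : ∀ m j → j < m → eval (fall m) (ι (+ j)) ≡ 0ℚ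
fall-root (suc m) j j<1+m
  rewrite eval-*ₚ (fall m) (linear m) (ι (+ j)) with ℕ.m≤n⇒m<n∨m≡n j<1+m
... | inj₁ (s≤s j<m) rewrite fall-root m j j<m = ℚ.*-zeroˡ (eval (linear m) (ι (+ j)))
... | inj₂ refl      rewrite eval-linear-root j = ℚ.*-zeroʳ (eval (fall j) (ι (+ j)))

linearCoeffs : ℕ → ℕ → ℤ
linearCoeffs m zero          = -ᶻ (+ m)
linearCoeffs m (suc zero)    = + 1
linearCoeffs m (suc (suc _)) = + 0

fallCoeffs : ℕ → ℕ → ℤ
fallCoeffs zero    = δ
fallCoeffs (suc m) = fallCoeffs m ⋆ linearCoeffs m

fall-IntCoeffs : ∀ m → IntCoeffs (fall m) (fallCoeffs m)
fall-IntCoeffs zero    = IntCoeffs-oneₚ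
fall-IntCoeffs (suc m) = IntCoeffs-*ₚ {fall m} {linear m} (fall-IntCoeffs m) linear-IntCoeffs
  where
  linear-IntCoeffs : IntCoeffs (linear m) (linearCoeffs m)
  linear-IntCoeffs zero          = refl
  linear-IntCoeffs (suc zero)    = refl
  linear-IntCoeffs (suc (suc i)) = refl

fallCoeffs-monic : ∀ m → MonicOfDegree m (fallCoeffs m)
fallCoeffs-monic zero    = (λ { (suc i) _ → refl }) , refl
fallCoeffs-monic (suc m) = vanishing , leading
  where
  fallCoeffs-suc : ∀ i → fallCoeffs (suc m) (suc i) ≡ fallCoeffs m (suc i) *ᶻ -ᶻ (+ m) +ᶻ fallCoeffs m i *ᶻ + 1
  fallCoeffs-suc = ⋆-linear (fallCoeffs m) (linearCoeffs m) (λ _ → refl)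
  vanishing : ∀ i → suc m < i → fallCoeffs (suc m) i ≡ + 0
  vanishing (suc i) (s≤s m<i)
    rewrite fallCoeffs-suc i
          | proj₁ (fallCoeffs-monic m) (suc i) (ℕ.m≤n⇒m≤1+n m<i)
          | proj₁ (fallCoeffs-monic m) i m<i
          = refl
  leading : fallCoeffs (suc m) (suc m) ≡ + 1
  leading rewrite fallCoeffs-suc m | proj₁ (fallCoeffs-monic m) (suc m) ℕ.≤-refl | proj₂ (fallCoeffs-monic m) = refl

-- Integer polynomials as coefficient lists, and root counting modulo a prime

horner : List ℤ → ℤ → ℤ
horner []      k = + 0
horner (c ∷ F) k = c +ᶻ k *ᶻ horner F k

horner-tabulate-zero : ∀ N {f} → (∀ i → f i ≡ + 0) → ∀ k → horner (tabulate {n = N} (f ∘ toℕ)) k ≡ + 0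
horner-tabulate-zero zero    f≡0 k = refl
horner-tabulate-zero (suc N) f≡0 k
  rewrite f≡0 0 | horner-tabulate-zero N (f≡0 ∘ suc) k | ℤ.*-zeroʳ k = refl

eval-horner : ∀ {F f} N → IntCoeffs F f → (∀ i → N ≤ i → f i ≡ + 0) → ∀ k →
  eval F (ι k) ≡ ι (horner (tabulate {n = N} (f ∘ toℕ)) k)
eval-horner {[]} {f} N       Ff f≡0 k = sym (cong ι (horner-tabulate-zero N {f} (IntCoeffs-[] Ff) k))
eval-horner {c ∷ F} {f} zero Ff f≡0 k
  rewrite Ff 0 | f≡0 0 z≤n | eval-horner {F} {f ∘ suc} zero (Ff ∘ suc) (λ i _ → f≡0 (suc i) z≤n) k =
  trans (ℚ.+-identityˡ (ι k *ᵠ 0ℚ)) (ℚ.*-zeroʳ (ι k))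
eval-horner {c ∷ F} {f} (suc N) Ff f≡0 k
  rewrite Ff 0 | eval-horner {F} {f ∘ suc} N (Ff ∘ suc) (λ i N≤i → f≡0 (suc i) (s≤s N≤i)) k =
  sym (trans (ι-homo-+ (f 0) _) (cong (ι (f 0) +ᵠ_) (ι-homo-* k _)))

-- syntheticDiv a G is the quotient of c ∷ G by x − a, whatever c is.
syntheticDiv : ℤ → List ℤ → List ℤ
syntheticDiv a []      = []
syntheticDiv a (d ∷ G) = horner (d ∷ G) a ∷ syntheticDiv a G

length-syntheticDiv : ∀ a G → length (syntheticDiv a G) ≡ length G
length-syntheticDiv a []      = refl
length-syntheticDiv a (d ∷ G) = cong suc (length-syntheticDiv a G)

horner-syntheticDiv : ∀ c G a k →
  horner (c ∷ G) k ≡ horner (c ∷ G) a +ᶻ (k -ᶻ a) *ᶻ horner (syntheticDiv a G) k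
horner-syntheticDiv c []      a k = identity c k a
  where
  identity : ∀ c k a → c +ᶻ k *ᶻ + 0 ≡ c +ᶻ a *ᶻ + 0 +ᶻ (k -ᶻ a) *ᶻ + 0
  identity = solve-∀
horner-syntheticDiv c (d ∷ G) a k
  rewrite horner-syntheticDiv d G a k = identity c k a (horner (d ∷ G) a) (horner (syntheticDiv a G) k)
  where
  identity : ∀ c k a D Q → c +ᶻ k *ᶻ (D +ᶻ (k -ᶻ a) *ᶻ Q) ≡ c +ᶻ a *ᶻ D +ᶻ (k -ᶻ a) *ᶻ (D +ᶻ k *ᶻ Q)
  identity = solve-∀

module Roots (p : ℕ) (p-prime : Prime p) where
  open Modulo p

  unit-cancel : ∀ j x → suc j < p → + suc j *ᶻ x ≈ + 0 → x ≈ + 0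
  unit-cancel j x j<p jx≈0 with euclidsLemma (suc j) ∣ x ∣ p-prime p∣j∣x∣
    where
    p∣j∣x∣ : p ℕᵈ.∣ suc j * ∣ x ∣
    p∣j∣x∣ = subst (p ℕᵈ.∣_) (ℤ.abs-* (+ suc j) x) (∣⇒∣ᵤ (≈0⇒∣ jx≈0))
  ... | inj₁ p∣j = ⊥-elim (ℕ.<⇒≱ j<p (ℕᵈ.∣⇒≤ p∣j))
  ... | inj₂ p∣x = ∣⇒≈0 (∣ᵤ⇒∣ p∣x)

  horner-≈0 : ∀ {G} k → All (_≈ + 0) G → horner G k ≈ + 0
  horner-≈0 k []          = ≈-refl
  horner-≈0 k (c≈0 ∷ G≈0) = +-≈0 c≈0 (*-≈0 k (horner-≈0 k G≈0))

  head-≈0 : ∀ c G a → horner (c ∷ G) a ≈ + 0 → All (_≈ + 0) G → c ≈ + 0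
  head-≈0 c G a root G≈0 = ≈0-cancelʳ root (*-≈0 a (horner-≈0 a G≈0))

  syntheticDiv-≈0 : ∀ a G → All (_≈ + 0) (syntheticDiv a G) → All (_≈ + 0) G
  syntheticDiv-≈0 a []      []             = []
  syntheticDiv-≈0 a (d ∷ G) (root ∷ Q≈0) = head-≈0 d G a root G≈0 ∷ G≈0
    where
    G≈0 : All (_≈ + 0) G
    G≈0 = syntheticDiv-≈0 a G Q≈0

  -- Dividing by x − a moves the roots a+1, …, a+m−1 to the quotient, because the
  -- factors 1, …, m−1 of x − a are units modulo p.
  roots⇒≈0 : ∀ F m a → length F ≤ m → m ≤ p → (∀ j → j < m → horner F (a +ᶻ + j) ≈ + 0) → All (_≈ + 0) F
  roots⇒≈0 []      m       a _          _   _     = []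
  roots⇒≈0 (c ∷ G) (suc m) a (s≤s |G|≤m) 1+m≤p roots = head-≈0 c G a root-a G≈0 ∷ G≈0
    where
    Q : List ℤ
    Q = syntheticDiv a G
    root-a : horner (c ∷ G) a ≈ + 0
    root-a = subst (λ v → horner (c ∷ G) v ≈ + 0) (ℤ.+-identityʳ a) (roots 0 (s≤s z≤n))
    Q-root : ∀ j → j < m → horner Q (a +ᶻ + 1 +ᶻ + j) ≈ + 0
    Q-root j j<m = unit-cancel j (horner Q k) (ℕ.≤-trans (s≤s j<m) 1+m≤p)
      (subst (λ v → v *ᶻ horner Q k ≈ + 0) (k-a≡1+j a (+ j))
        (≈0-cancelˡ root-a (subst (_≈ + 0) (horner-syntheticDiv c G a k) root-k)))
      where
      k : ℤ
      k = a +ᶻ + 1 +ᶻ + j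
      root-k : horner (c ∷ G) k ≈ + 0
      root-k = subst (λ v → horner (c ∷ G) v ≈ + 0) (sym (ℤ.+-assoc a (+ 1) (+ j))) (roots (suc j) (s≤s j<m))
      k-a≡1+j : ∀ a j → a +ᶻ + 1 +ᶻ j -ᶻ a ≡ + 1 +ᶻ j
      k-a≡1+j = solve-∀
    G≈0 : All (_≈ + 0) G
    G≈0 = syntheticDiv-≈0 a G
      (roots⇒≈0 Q m (a +ᶻ + 1) (subst (_≤ m) (sym (length-syntheticDiv a G)) |G|≤m)
                (ℕ.≤-trans (ℕ.n≤1+n m) 1+m≤p) Q-root)

-- The congruence A_p ≡ x(x-1)⋯(x-p+1) (mod p)

n∣n! : ∀ n → .{{NonZero n}} → n ℕᵈ.∣ n !
n∣n! (suc n) = ℕᵈ.m∣m*n (n !)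

module FallingFactorialCongruence
  (g : ℕ → ℤ) (g1 : g 1 ≡ + 1) (p : ℕ) (p-prime : Prime p) (integer-valued : IntegerValued g) where
  open Coefficients g
  open Modulo p
  open Roots p p-prime

  D : Poly
  D = A g p +ₚ scale (ι (-ᶻ + 1)) (fall p)

  d : ℕ → ℤ
  d i = a p i -ᶻ fallCoeffs p i

  D-IntCoeffs : IntCoeffs D d
  D-IntCoeffs i =
    trans (IntCoeffs-+ₚ {A g p} {scale (ι (-ᶻ + 1)) (fall p)} {a p} {λ i → -ᶻ + 1 *ᶻ fallCoeffs p i}
                        (A-IntCoeffs p) (IntCoeffs-scale {fall p} {fallCoeffs p} (-ᶻ + 1) (fall-IntCoeffs p)) i)
          (cong (λ v → ι (a p i +ᶻ v)) (ℤ.-1*i≡-i (fallCoeffs p i)))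

  d-vanishes : ∀ i → p ≤ i → d i ≡ + 0
  d-vanishes i p≤i with ℕ.m≤n⇒m<n∨m≡n p≤i
  ... | inj₁ p<i rewrite proj₁ (a-monic g1 p) i p<i | proj₁ (fallCoeffs-monic p) i p<i = refl
  ... | inj₂ refl rewrite proj₂ (a-monic g1 p) | proj₂ (fallCoeffs-monic p) = refl

  d-root : ∀ j → j < p → horner (tabulate {n = p} (d ∘ toℕ)) (+ 0 +ᶻ + j) ≈ + 0
  d-root j j<p = ∣⇒≈0 (subst (+ p ∣_) (ι-injective value) (∣m⇒∣m*n z p∣p!))
    where
    p∣p! : + p ∣ + (p !)
    p∣p! = ∣ᵤ⇒∣ (n∣n! p {{prime⇒nonZero p-prime}})
    t : ℚ
    t = ι (+ j)
    z : ℤ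
    z = proj₁ (integer-valued p (+ j))
    -1ᵠ : ℚ
    -1ᵠ = ι (-ᶻ + 1)
    value : ι (+ (p !) *ᶻ z) ≡ ι (horner (tabulate {n = p} (d ∘ toℕ)) (+ j))
    value = begin
      ι (+ (p !) *ᶻ z)
        ≡⟨ ι-homo-* (+ (p !)) z ⟩
      ι (+ (p !)) *ᵠ ι z
        ≡⟨ cong (ι (+ (p !)) *ᵠ_) (sym (proj₂ (integer-valued p (+ j)))) ⟩
      ι (+ (p !)) *ᵠ eval (P g p) t
        ≡⟨ sym (eval-scale (ι (+ (p !))) (P g p) t) ⟩
      eval (A g p) t
        ≡⟨ sym (ℚ.+-identityʳ (eval (A g p) t)) ⟩
      eval (A g p) t +ᵠ 0ℚ
        ≡⟨ cong (eval (A g p) t +ᵠ_) (sym (trans (cong (-1ᵠ *ᵠ_) (fall-root p j j<p)) (ℚ.*-zeroʳ -1ᵠ))) ⟩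
      eval (A g p) t +ᵠ -1ᵠ *ᵠ eval (fall p) t
        ≡⟨ cong (eval (A g p) t +ᵠ_) (sym (eval-scale -1ᵠ (fall p) t)) ⟩
      eval (A g p) t +ᵠ eval (scale -1ᵠ (fall p)) t
        ≡⟨ sym (eval-+ₚ (A g p) (scale -1ᵠ (fall p)) t) ⟩
      eval D t
        ≡⟨ eval-horner {D} {d} p D-IntCoeffs d-vanishes (+ j) ⟩
      ι (horner (tabulate {n = p} (d ∘ toℕ)) (+ j))
        ∎
      where open ≡-Reasoning

  d≈0 : ∀ i → d i ≈ + 0
  d≈0 i with i ℕ.<? p
  ... | yes i<p = subst (_≈ + 0) (cong d (toℕ-fromℕ< i<p)) (tabulate⁻ all-≈0 (fromℕ< i<p))
    where
    all-≈0 : All (_≈ + 0) (tabulate {n = p} (d ∘ toℕ))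
    all-≈0 =
      roots⇒≈0 (tabulate (d ∘ toℕ)) p (+ 0) (ℕ.≤-reflexive (length-tabulate (d ∘ toℕ))) ℕ.≤-refl d-root
  ... | no i≮p  = ≈-reflexive (d-vanishes i (ℕ.≮⇒≥ i≮p))

  A-p≡fall : A g p ≡ₚ fall p [mod p ]
  A-p≡fall = IntCoeffs-≡ₚ {A g p} {fall p} (A-IntCoeffs p) (fall-IntCoeffs p)
    (λ i → x-y≈0⇒x≈y {a p i} {fallCoeffs p i} (d≈0 i))

lemma1 : (g : ℕ → ℤ) → g 1 ≡ + 1 → (p : ℕ) → Prime p →
    ((ℓ r : ℕ) → r < p → A g (ℓ * p + r) ≡ₚ (A g r *ₚ (A g p ^ₚ ℓ)) [mod p ])
    × (IntegerValued g → A g p ≡ₚ fall p [mod p ])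
lemma1 g g1 p p-prime =
  (λ ℓ r _ → Periodicity.A-periodic g p ℓ r) , FallingFactorialCongruence.A-p≡fall g g1 p p-prime
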